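{- Let $\Gamma>0$ be an ordinal, $\mathcal{M}=(W,R,V)$ a Kripke model, $w_0\in W$ and $\varphi_0$ a sentence of the modal $\mu$-calculus. Then $\mathcal{M},w_0\vDash^\Gamma\varphi_0$ (truth under $\Gamma$-bounded compositional semantics) if and only if $\mathcal{M},w_0\Vdash^\Gamma\varphi_0$ (truth under $\Gamma$-bounded game-theoretic semantics).
   Context: Formulae of the modal $\mu$-calculus over proposition symbols $\Phi$ and label symbols $\Lambda$: $\varphi ::= p \mid \neg p \mid X \mid \varphi\vee\varphi \mid \varphi\wedge\varphi \mid \Diamond\varphi \mid \Box\varphi \mid \mu X\varphi \mid \nu X\varphi$. $\mathrm{Sub}(\varphi)$: nodes of the syntax tree (occurrences distinguished); $\mathrm{Sub}_{\mu\nu}(\varphi)$: those of form $\mu X\psi$ or $\nu X\psi$. A sentence has no free label occurrences. For an occurrence of $X$ in a sentence $\varphi_0$, $\mathrm{rf}(X)$ is the nearest ancestor in the syntax tree of the form $\mu X\psi$ or $\nu X\psi$. Kripke model $\mathcal{M}=(W,R,V)$, $W\ne\emptyset$, $R\subseteq W^2$, $V:\Phi\to\mathcal{P}(W)$; an assignment is $s:\Lambda\to\mathcal{P}(W)$. Approximants: for $F:\mathcal{P}(W)\to\mathcal{P}(W)$, $F^0_\mu=\emptyset$, $F^0_\nu=W$; $F^\gamma_\mu=F(F^{\gamma-1}_\mu)$, $F^\gamma_\nu=F(F^{\gamma-1}_\nu)$ for successor $\gamma$; $F^\gamma_\mu=\bigcup_{\delta<\gamma}F^\delta_\mu$, $F^\gamma_\nu=\bigcap_{\delta<\gamma}F^\delta_\nu$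 for limit $\gamma$. $\Gamma$-bounded compositional semantics $\mathcal{M},w\vDash^\Gamma_s\varphi$: literals, $\vee,\wedge$, $\Diamond$, $\Box$ as in modal logic; $\mathcal{M},w\vDash^\Gamma_s X$ iff $w\in s(X)$; $\mathcal{M},w\vDash^\Gamma_s\mu X\psi$ iff $w\in (F_{\psi,X,s,\Gamma})^\Gamma_\mu$ and $\mathcal{M},w\vDash^\Gamma_s\nu X\psi$ iff $w\in (F_{\psi,X,s,\Gamma})^\Gamma_\nu$, where $F_{\psi,X,s,\Gamma}(A)=\{v\in W\mid \mathcal{M},v\vDash^\Gamma_{s[A/X]}\psi\}$ and $s[A/X]$ maps $X$ to $A$ and agrees with $s$ elsewhere. For sentences truth is independent of $s$ and written $\mathcal{M},w\vDash^\Gamma\varphi$. $\Gamma$-bounded evaluation game $(\mathcal{M},w_0,\varphi_0,\Gamma)$: players Eloise and Abelard; positions $(w,\varphi,c)$ with $w\in W$, $\varphi\in\mathrm{Sub}(\varphi_0)$, $c:\mathrm{Sub}_{\mu\nu}(\varphi_0)\to\{\gamma\mid\gamma\le\Gamma\}$; initial position $(w_0,\varphi_0,c_0)$ with $c_0\equiv\Gamma$. At $(w,p,c)$ Eloise wins iff $w\in V(p)$ (else Abelard wins); at $(w,\neg p,c)$ Eloise wins iff $w\notin V(p)$ (else Abelard wins); at $\psi\vee\theta$ Eloise picks a disjunct, at $\psi\wedge\theta$ Abelard picks a conjunct (same $w,c$); at $\Diamond\psi$ Eloise picks an $R$-successor $v$ and play goes to $(v,\psi,c)$, Abelard winning if none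 exists; at $\Box\psi$ Abelard picks an $R$-successor, Eloise winning if none exists; at $(w,\mu X\psi,c)$ Eloise chooses $\gamma<\Gamma$ and play goes to $(w,\psi,c[\gamma/\mu X\psi])$; at $(w,\nu X\psi,c)$ Abelard chooses $\gamma<\Gamma$ likewise. At $(w,X,c)$ with $\gamma=c(\mathrm{rf}(X))$: if $\mathrm{rf}(X)=\mu X\psi$, Abelard wins if $\gamma=0$, else Eloise chooses $\gamma'<\gamma$ and play goes to $(w,\psi,c')$ with $c'(\mu X\psi)=\gamma'$, $c'(\theta)=\Gamma$ for all $\theta\in\mathrm{Sub}_{\mu\nu}(\varphi_0)$ inside $\psi$, and $c'(\theta)=c(\theta)$ otherwise; if $\mathrm{rf}(X)=\nu X\psi$, the same with Eloise and Abelard swapped. A strategy for Eloise assigns her a legal choice at each position where she moves; it is winning if she wins every play in which she follows it. $\mathcal{M},w_0\Vdash^\Gamma\varphi_0$ iff Eloise has a winning strategy in $(\mathcal{M},w_0,\varphi_0,\Gamma)$. -}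

module Defs where

open import Data.Bool using (Bool; true; false; if_then_else_; _∧_; _∨_)
open import Data.Empty using (⊥)
open import Data.Unit using (⊤)
open import Data.List using (List; []; _∷_; _++_; [_])
open import Data.List.Membership.Propositional using (_∈_)
open import Data.Maybe using (Maybe; just; nothing)
open import Data.Product using (Σ; _×_; _,_; proj₁; proj₂)
open import Data.Sum using (_⊎_; inj₁; inj₂)
open import Induction.WellFounded using (WellFounded; Acc; acc)
open import Relation.Binary.Core using (Rel)
open import Relation.Binary.Definitions using (DecidableEquality)
open import Relation.Binary.Structures using (IsStrictTotalOrder)
open import Relation.Binary.PropositionalEquality using (_≡_)
open import Relation.Nullary using (¬_; does)

data Fm (Φ Λ : Set) : Set where
  prop  : Φ → Fm Φ Λ
  nprop : Φ → Fm Φ Λ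
  var   : Λ → Fm Φ Λ
  _⋁_   : Fm Φ Λ → Fm Φ Λ → Fm Φ Λ
  _⋀_   : Fm Φ Λ → Fm Φ Λ → Fm Φ Λ
  ◇     : Fm Φ Λ → Fm Φ Λ
  □     : Fm Φ Λ → Fm Φ Λ
  μ     : Λ → Fm Φ Λ → Fm Φ Λ
  ν     : Λ → Fm Φ Λ → Fm Φ Λ

Closed : {Φ Λ : Set} → List Λ → Fm Φ Λ → Set
Closed bs (prop p)  = ⊤
Closed bs (nprop p) = ⊤
Closed bs (var X)   = X ∈ bs
Closed bs (φ ⋁ ψ)   = Closed bs φ × Closed bs ψ
Closed bs (φ ⋀ ψ)   = Closed bs φ × Closed bs ψ
Closed bs (◇ φ)     = Closed bs φ
Closed bs (□ φ)     = Closed bs φ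
Closed bs (μ X φ)   = Closed (X ∷ bs) φ
Closed bs (ν X φ)   = Closed (X ∷ bs) φ

Sentence : {Φ Λ : Set} → Fm Φ Λ → Set
Sentence = Closed []

record Kripke (Φ : Set) : Set₁ where
  field
    W    : Set
    W≠∅  : W
    R    : W → W → Set
    V    : Φ → W → Set

-- An ordinal Γ, represented by the well-ordered set of all ordinals
-- γ ≤ Γ (the ordinal Γ + 1), with Γ its greatest element.

record OrdinalsUpTo : Set₁ where
  field
    Ord     : Set
    _<_     : Rel Ord _
    isSTO   : IsStrictTotalOrder _≡_ _<_
    wf      : WellFounded _<_
    Γ       : Ord
    Γ-max   : ∀ γ → γ < Γ ⊎ γ ≡ Γ

Positive : OrdinalsUpTo → Set
Positive Ω = Σ Ord λ γ → γ < Γ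
  where open OrdinalsUpTo Ω

-- Addresses of occurrences (nodes of the syntax tree), root first.

data Dir : Set where
  left right down : Dir

eqDir : Dir → Dir → Bool
eqDir left left = true
eqDir right right = true
eqDir down down = true
eqDir _ _ = false

eqAddr : List Dir → List Dir → Bool
eqAddr [] [] = true
eqAddr (d ∷ a) (e ∷ b) = eqDir d e ∧ eqAddr a b
eqAddr _ _ = false

isPrefix : List Dir → List Dir → Bool
isPrefix [] _ = true
isPrefix (d ∷ a) [] = false
isPrefix (d ∷ a) (e ∷ b) = eqDir d e ∧ isPrefix a b

at : {Φ Λ : Set} → Fm Φ Λ → List Dir → Maybe (Fm Φ Λ)
at φ [] = just φ
at (φ ⋁ ψ) (left ∷ a) = at φ a
at (φ ⋁ ψ) (right ∷ a) = at ψ a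
at (φ ⋀ ψ) (left ∷ a) = at φ a
at (φ ⋀ ψ) (right ∷ a) = at ψ a
at (◇ φ) (down ∷ a) = at φ a
at (□ φ) (down ∷ a) = at φ a
at (μ X φ) (down ∷ a) = at φ a
at (ν X φ) (down ∷ a) = at φ a
at _ _ = nothing

data Kind : Set where
  μK νK : Kind

module _ {Φ Λ : Set} (_≟_ : DecidableEquality Λ) where

  -- rf: address (and kind) of the nearest ancestor binding the label X
  rfGo : Λ → Fm Φ Λ → List Dir → List Dir → Maybe (Kind × List Dir)
       → Maybe (Kind × List Dir)
  rfGo X φ [] cur best = best
  rfGo X (φ ⋁ ψ) (left ∷ a) cur best = rfGo X φ a (cur ++ [ left ]) best
  rfGo X (φ ⋁ ψ) (right ∷ a) cur best = rfGo X ψ a (cur ++ [ right ]) best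
  rfGo X (φ ⋀ ψ) (left ∷ a) cur best = rfGo X φ a (cur ++ [ left ]) best
  rfGo X (φ ⋀ ψ) (right ∷ a) cur best = rfGo X ψ a (cur ++ [ right ]) best
  rfGo X (◇ φ) (down ∷ a) cur best = rfGo X φ a (cur ++ [ down ]) best
  rfGo X (□ φ) (down ∷ a) cur best = rfGo X φ a (cur ++ [ down ]) best
  rfGo X (μ Y φ) (down ∷ a) cur best =
    rfGo X φ a (cur ++ [ down ]) (if does (Y ≟ X) then just (μK , cur) else best)
  rfGo X (ν Y φ) (down ∷ a) cur best =
    rfGo X φ a (cur ++ [ down ]) (if does (Y ≟ X) then just (νK , cur) else best)
  rfGo X _ _ cur best = nothing

  rf : Fm Φ Λ → List Dir → Λ → Maybe (Kind × List Dir)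
  rf φ₀ a X = rfGo X φ₀ a [] nothing

  module _ (M : Kripke Φ) (Ω : OrdinalsUpTo) where
    open Kripke M
    open OrdinalsUpTo Ω

    -- Approximants F^γ_μ, F^γ_ν (defined by well-founded recursion;
    -- γ is a successor with predecessor δ, or a limit (incl. 0)).

    IsPred : Ord → Ord → Set
    IsPred δ γ = δ < γ × (∀ ε → δ < ε → ¬ (ε < γ))

    IsLimit : Ord → Set
    IsLimit γ = ¬ (Σ Ord λ δ → IsPred δ γ)

    approxμ : ((W → Set) → W → Set) → (γ : Ord) → Acc _<_ γ → W → Set
    approxμ F γ (acc rs) w =
      (Σ Ord λ δ → Σ (IsPred δ γ) λ p → F (approxμ F δ (rs (proj₁ p))) w)
      ⊎ (IsLimit γ × (Σ Ord λ δ → Σ (δ < γ) λ lt → approxμ F δ (rs lt) w))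

    approxν : ((W → Set) → W → Set) → (γ : Ord) → Acc _<_ γ → W → Set
    approxν F γ (acc rs) w =
      (Σ Ord λ δ → Σ (IsPred δ γ) λ p → F (approxν F δ (rs (proj₁ p))) w)
      ⊎ (IsLimit γ × (∀ δ → (lt : δ < γ) → approxν F δ (rs lt) w))

    Assignment : Set₁
    Assignment = Λ → W → Set

    _[_/_] : Assignment → (W → Set) → Λ → Assignment
    (s [ A / X ]) Y = if does (Y ≟ X) then A else s Y

    sat : Fm Φ Λ → Assignment → W → Set
    sat (prop p) s w = V p w
    sat (nprop p) s w = ¬ V p w
    sat (var X) s w = s X w
    sat (φ ⋁ ψ) s w = sat φ s w ⊎ sat ψ s w
    sat (φ ⋀ ψ) s w = sat φ s w × sat ψ s w
    sat (◇ φ) s w = Σ W λ v → R w v × sat φ s v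
    sat (□ φ) s w = ∀ v → R w v → sat φ s v
    sat (μ X φ) s w = approxμ (λ A → sat φ (s [ A / X ])) Γ (wf Γ) w
    sat (ν X φ) s w = approxν (λ A → sat φ (s [ A / X ])) Γ (wf Γ) w

    CompTrue : Fm Φ Λ → W → Set
    CompTrue φ w = sat φ (λ _ _ → ⊥) w

    -- Γ-bounded evaluation game for a fixed φ₀.
    -- Positions: (w, a, c) with a the address of an occurrence in φ₀ and
    -- c the counter (only its values at μ/ν-addresses matter).

    module Game (φ₀ : Fm Φ Λ) where

      Counter : Set
      Counter = List Dir → Ord

      c₀ : Counter
      c₀ _ = Γ

      setC : Counter → List Dir → Ord → Counter
      setC c b γ a = if eqAddr a b then γ else c a

      resetC : Counter → List Dir → Ord → Counter
      resetC c b γ a =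
        if eqAddr a b then γ
        else (if isPrefix (b ++ [ down ]) a then Γ else c a)

      -- positional strategies for Eloise: a legal choice at each of her
      -- positions (or evidence that she has no legal move there)
      record Strategy : Set where
        field
          orS  : ∀ (w : W) (a : List Dir) (c : Counter) {ψ θ} → at φ₀ a ≡ just (ψ ⋁ θ) → Bool
          diaS : ∀ (w : W) (a : List Dir) (c : Counter) {ψ} → at φ₀ a ≡ just (◇ ψ)
               → (Σ W λ v → R w v) ⊎ ¬ (Σ W λ v → R w v)
          muS  : ∀ (w : W) (a : List Dir) (c : Counter) {X ψ} → at φ₀ a ≡ just (μ X ψ)
               → Σ Ord λ γ → γ < Γ
          varS : ∀ (w : W) (a : List Dir) (c : Counter) {X b} → at φ₀ a ≡ just (var X)
               → rf φ₀ a X ≡ just (μK , b)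
               → (Σ Ord λ γ' → γ' < c b) ⊎ ¬ (Σ Ord λ γ' → γ' < c b)

      open Strategy

      -- Wins σ w a c : every play from (w, a, c) in which Eloise follows
      -- σ is won by Eloise (all plays of this game are finite).
      data Wins (σ : Strategy) : W → List Dir → Counter → Set where
        wProp  : ∀ {w a c p} → at φ₀ a ≡ just (prop p) → V p w → Wins σ w a c
        wNProp : ∀ {w a c p} → at φ₀ a ≡ just (nprop p) → ¬ V p w
               → Wins σ w a c
        wOr    : ∀ {w a c ψ θ} (e : at φ₀ a ≡ just (ψ ⋁ θ))
               → Wins σ w (a ++ [ (if orS σ w a c e then left else right) ]) c
               → Wins σ w a c
        wAnd   : ∀ {w a c ψ θ} → at φ₀ a ≡ just (ψ ⋀ θ)
               → Wins σ w (a ++ [ left ]) c → Wins σ w (a ++ [ right ]) c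
               → Wins σ w a c
        wDia   : ∀ {w a c ψ} (e : at φ₀ a ≡ just (◇ ψ)) (v : W) (r : R w v)
               → diaS σ w a c e ≡ inj₁ (v , r)
               → Wins σ v (a ++ [ down ]) c → Wins σ w a c
        wBox   : ∀ {w a c ψ} → at φ₀ a ≡ just (□ ψ)
               → (∀ (v : W) → R w v → Wins σ v (a ++ [ down ]) c) → Wins σ w a c
        wMu    : ∀ {w a c X ψ} (e : at φ₀ a ≡ just (μ X ψ))
               → Wins σ w (a ++ [ down ]) (setC c a (proj₁ (muS σ w a c e)))
               → Wins σ w a c
        wNu    : ∀ {w a c X ψ} → at φ₀ a ≡ just (ν X ψ)
               → (∀ γ → γ < Γ → Wins σ w (a ++ [ down ]) (setC c a γ))
               → Wins σ w a c
        wVarμ  : ∀ {w a c X b} (e : at φ₀ a ≡ just (var X))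
               → (f : rf φ₀ a X ≡ just (μK , b))
               → (γ' : Ord) (lt : γ' < c b) → varS σ w a c e f ≡ inj₁ (γ' , lt)
               → Wins σ w (b ++ [ down ]) (resetC c b γ')
               → Wins σ w a c
        wVarν  : ∀ {w a c X b} → at φ₀ a ≡ just (var X)
               → rf φ₀ a X ≡ just (νK , b)
               → (∀ γ' → γ' < c b → Wins σ w (b ++ [ down ]) (resetC c b γ'))
               → Wins σ w a c

    GameTrue : Fm Φ Λ → W → Set
    GameTrue φ₀ w₀ = Σ Strategy λ σ → Wins σ w₀ [] c₀
      where open Game φ₀

-- A position (w, a, c) of the evaluation game is read as the claim that the
-- subformula at address a holds at w when every binder b above a is
-- interpreted by its approximant of stage c(b).  The approximants satisfy
-- F^γ_μ = ⋃_{δ<γ} F(F^δ_μ) and F^γ_ν = ⋂_{δ<γ} F(F^δ_ν), so every rule of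
-- the game turns a true claim into true claims for Eloise's chosen move
-- (respectively for all of Abelard's moves).  Hence truth propagates back up
-- any won play, and conversely Eloise wins by always moving to a true claim:
-- regenerating a μ-variable strictly lowers the counter of its binder, so a
-- well-founded induction on that counter, nested in the structural induction
-- on the formula, shows that every true position is won.
module Submission where

open import Defs
open import Axiom.ExcludedMiddle using (ExcludedMiddle)
open import Data.Bool using (Bool; true; false; if_then_else_)
open import Data.Empty using (⊥; ⊥-elim)
open import Data.List using (List; []; _∷_; _++_; [_])
open import Data.List.Properties using (++-assoc; ++-identityʳ)
open import Data.Maybe using (Maybe; just; nothing; maybe′; _>>=_)
open import Data.Product using (Σ-syntax; ∃; ∃-syntax; _×_; _,_; proj₁; proj₂)
open import Data.Sum using (_⊎_; inj₁; inj₂)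
open import Data.Unit using (⊤; tt)
open import Function.Bundles using (_⇔_; mk⇔; module Equivalence)
open import Induction.WellFounded using (Acc; acc)
open import Relation.Binary.Definitions using (DecidableEquality; tri<; tri≈; tri>)
open import Relation.Binary.Structures using (IsStrictTotalOrder)
open import Relation.Binary.PropositionalEquality
  using (_≡_; _≢_; refl; sym; trans; cong; cong₂; subst; subst₂; module ≡-Reasoning; ≢-sym)
open import Relation.Nullary using (¬_; Dec; yes; no; does)
open import Relation.Nullary.Decidable using (dec-true; dec-false)

open Equivalence using (to; from)

if-true : ∀ {a} {A : Set a} {b : Bool} {x y : A} → b ≡ true → (if b then x else y) ≡ x
if-true refl = refl

if-false : ∀ {a} {A : Set a} {b : Bool} {x y : A} → b ≡ false → (if b then x else y) ≡ y
if-false refl = refl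

module _ {A : Set} {P T : A → Set} where

  pick : Dec (∃[ x ] P x × T x) → ∃ P → ∃ P
  pick (yes (x , p , _)) _ = x , p
  pick (no _)            e = e

  pick-spec : (d : Dec (∃[ x ] P x × T x)) (e : ∃ P) → ∃[ x ] P x × T x → T (proj₁ (pick d e))
  pick-spec (yes (_ , _ , t)) _ _  = t
  pick-spec (no ∄x)           _ pt = ⊥-elim (∄x pt)

  pickOrRefute : Dec (∃[ x ] P x × T x) → Dec (∃ P) → ∃ P ⊎ ¬ ∃ P
  pickOrRefute d (yes e) = inj₁ (pick d e)
  pickOrRefute d (no ∄e) = inj₂ ∄e

  pickOrRefute-spec : (d : Dec (∃[ x ] P x × T x)) (d′ : Dec (∃ P)) → ∃[ x ] P x × T x
                    → ∃[ e ] pickOrRefute d d′ ≡ inj₁ e × T (proj₁ e)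
  pickOrRefute-spec d (yes e) pt          = pick d e , refl , pick-spec d e pt
  pickOrRefute-spec d (no ∄e) (x , p , _) = ⊥-elim (∄e (x , p))

infix 4 _⊏_

data _⊏_ {A : Set} : List A → List A → Set where
  []⊏∷ : ∀ {x xs} → [] ⊏ x ∷ xs
  ∷⊏∷  : ∀ {x xs ys} → xs ⊏ ys → x ∷ xs ⊏ x ∷ ys

module _ {A : Set} where

  ⊏-trans : ∀ {xs ys zs : List A} → xs ⊏ ys → ys ⊏ zs → xs ⊏ zs
  ⊏-trans []⊏∷    (∷⊏∷ _) = []⊏∷
  ⊏-trans (∷⊏∷ p) (∷⊏∷ q) = ∷⊏∷ (⊏-trans p q)

  ⊏-∷ʳ : ∀ {xs ys : List A} {y} → xs ⊏ ys → xs ⊏ ys ++ [ y ]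
  ⊏-∷ʳ []⊏∷    = []⊏∷
  ⊏-∷ʳ (∷⊏∷ p) = ∷⊏∷ (⊏-∷ʳ p)

  xs⊏xs∷ʳx : ∀ (xs : List A) {x} → xs ⊏ xs ++ [ x ]
  xs⊏xs∷ʳx []       = []⊏∷
  xs⊏xs∷ʳx (_ ∷ xs) = ∷⊏∷ (xs⊏xs∷ʳx xs)

  ⊏-∷ʳ⁻¹ : ∀ {xs} (ys : List A) {y} → xs ⊏ ys ++ [ y ] → xs ≡ ys ⊎ xs ⊏ ys
  ⊏-∷ʳ⁻¹ []       []⊏∷       = inj₁ refl
  ⊏-∷ʳ⁻¹ []       (∷⊏∷ ())
  ⊏-∷ʳ⁻¹ (_ ∷ _)  []⊏∷       = inj₂ []⊏∷
  ⊏-∷ʳ⁻¹ (_ ∷ ys) (∷⊏∷ p) with ⊏-∷ʳ⁻¹ ys p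
  ... | inj₁ refl = inj₁ refl
  ... | inj₂ q    = inj₂ (∷⊏∷ q)

eqDir-refl : ∀ d → eqDir d d ≡ true
eqDir-refl left  = refl
eqDir-refl right = refl
eqDir-refl down  = refl

eqAddr-refl : ∀ a → eqAddr a a ≡ true
eqAddr-refl []      = refl
eqAddr-refl (d ∷ a) rewrite eqDir-refl d = eqAddr-refl a

eqAddr-⊏ : ∀ {a b} → a ⊏ b → eqAddr a b ≡ false
eqAddr-⊏ []⊏∷              = refl
eqAddr-⊏ (∷⊏∷ {x = d} a⊏b) rewrite eqDir-refl d = eqAddr-⊏ a⊏b

isPrefix-⊏ : ∀ {a b} → a ⊏ b → isPrefix (b ++ [ down ]) a ≡ false
isPrefix-⊏ []⊏∷              = refl
isPrefix-⊏ (∷⊏∷ {x = d} a⊏b) rewrite eqDir-refl d = isPrefix-⊏ a⊏b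

binder : ∀ {Φ Λ} → Kind → Λ → Fm Φ Λ → Fm Φ Λ
binder μK = μ
binder νK = ν

IsBinder : ∀ {Φ Λ} → Maybe (Fm Φ Λ) → Set
IsBinder (just (μ _ _)) = ⊤
IsBinder (just (ν _ _)) = ⊤
IsBinder _              = ⊥

IsBinder-binder : ∀ {Φ Λ} k {X : Λ} {ψ : Fm Φ Λ} → IsBinder (just (binder k X ψ))
IsBinder-binder μK = tt
IsBinder-binder νK = tt

module Navigation {Φ Λ : Set} (_≟_ : DecidableEquality Λ) where

  child : Fm Φ Λ → Dir → Maybe (Fm Φ Λ)
  child (φ ⋁ _) left  = just φ
  child (_ ⋁ ψ) right = just ψ
  child (φ ⋀ _) left  = just φ
  child (_ ⋀ ψ) right = just ψ
  child (◇ φ)   down  = just φ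
  child (□ φ)   down  = just φ
  child (μ _ φ) down  = just φ
  child (ν _ φ) down  = just φ
  child _       _     = nothing

  child-binder : ∀ k {X ψ} → child (binder k X ψ) down ≡ just ψ
  child-binder μK = refl
  child-binder νK = refl

  at-∷ : ∀ φ d a → at φ (d ∷ a) ≡ (child φ d >>= λ ψ → at ψ a)
  at-∷ (prop _)  _     _ = refl
  at-∷ (nprop _) _     _ = refl
  at-∷ (var _)   _     _ = refl
  at-∷ (_ ⋁ _)   left  _ = refl
  at-∷ (_ ⋁ _)   right _ = refl
  at-∷ (_ ⋁ _)   down  _ = refl
  at-∷ (_ ⋀ _)   left  _ = refl
  at-∷ (_ ⋀ _)   right _ = refl
  at-∷ (_ ⋀ _)   down  _ = refl
  at-∷ (◇ _)     left  _ = refl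
  at-∷ (◇ _)     right _ = refl
  at-∷ (◇ _)     down  _ = refl
  at-∷ (□ _)     left  _ = refl
  at-∷ (□ _)     right _ = refl
  at-∷ (□ _)     down  _ = refl
  at-∷ (μ _ _)   left  _ = refl
  at-∷ (μ _ _)   right _ = refl
  at-∷ (μ _ _)   down  _ = refl
  at-∷ (ν _ _)   left  _ = refl
  at-∷ (ν _ _)   right _ = refl
  at-∷ (ν _ _)   down  _ = refl

  at-∷-child : ∀ {φ d ψ} a → child φ d ≡ just ψ → at φ (d ∷ a) ≡ at ψ a
  at-∷-child {φ} {d} a cd = trans (at-∷ φ d a) (cong (_>>= λ ψ → at ψ a) cd)

  at-∷⁻¹ : ∀ φ d a {χ} → at φ (d ∷ a) ≡ just χ → ∃[ ψ ] child φ d ≡ just ψ × at ψ a ≡ just χ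
  at-∷⁻¹ φ d a h with child φ d | at-∷ φ d a
  ... | just ψ  | eq = ψ , refl , trans (sym eq) h
  ... | nothing | eq with () ← trans (sym eq) h

  at-child : ∀ φ a {χ d ψ} → at φ a ≡ just χ → child χ d ≡ just ψ → at φ (a ++ [ d ]) ≡ just ψ
  at-child φ []      refl cd = at-∷-child [] cd
  at-child φ (e ∷ a) {d = d} h cd =
    let (φ′ , ce , h′) = at-∷⁻¹ φ e a h
    in trans (at-∷-child (a ++ [ d ]) ce) (at-child φ′ a h′ cd)

  rfStep : Λ → Fm Φ Λ → List Dir → Maybe (Kind × List Dir) → Maybe (Kind × List Dir)
  rfStep X (μ Y _) cur best = if does (Y ≟ X) then just (μK , cur) else best
  rfStep X (ν Y _) cur best = if does (Y ≟ X) then just (νK , cur) else best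
  rfStep X _       cur best = best

  rfGo-∷ : ∀ X φ d a cur best → rfGo _≟_ X φ (d ∷ a) cur best
         ≡ (child φ d >>= λ ψ → rfGo _≟_ X ψ a (cur ++ [ d ]) (rfStep X φ cur best))
  rfGo-∷ X (prop _)  _     _ _ _ = refl
  rfGo-∷ X (nprop _) _     _ _ _ = refl
  rfGo-∷ X (var _)   _     _ _ _ = refl
  rfGo-∷ X (_ ⋁ _)   left  _ _ _ = refl
  rfGo-∷ X (_ ⋁ _)   right _ _ _ = refl
  rfGo-∷ X (_ ⋁ _)   down  _ _ _ = refl
  rfGo-∷ X (_ ⋀ _)   left  _ _ _ = refl
  rfGo-∷ X (_ ⋀ _)   right _ _ _ = refl
  rfGo-∷ X (_ ⋀ _)   down  _ _ _ = refl
  rfGo-∷ X (◇ _)     left  _ _ _ = refl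
  rfGo-∷ X (◇ _)     right _ _ _ = refl
  rfGo-∷ X (◇ _)     down  _ _ _ = refl
  rfGo-∷ X (□ _)     left  _ _ _ = refl
  rfGo-∷ X (□ _)     right _ _ _ = refl
  rfGo-∷ X (□ _)     down  _ _ _ = refl
  rfGo-∷ X (μ _ _)   left  _ _ _ = refl
  rfGo-∷ X (μ _ _)   right _ _ _ = refl
  rfGo-∷ X (μ _ _)   down  _ _ _ = refl
  rfGo-∷ X (ν _ _)   left  _ _ _ = refl
  rfGo-∷ X (ν _ _)   right _ _ _ = refl
  rfGo-∷ X (ν _ _)   down  _ _ _ = refl

  rfGo-∷-child : ∀ {X φ d ψ} a cur best → child φ d ≡ just ψ
               → rfGo _≟_ X φ (d ∷ a) cur best ≡ rfGo _≟_ X ψ a (cur ++ [ d ]) (rfStep X φ cur best)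
  rfGo-∷-child {X} {φ} {d} a cur best cd =
    trans (rfGo-∷ X φ d a cur best) (cong (_>>= λ ψ → rfGo _≟_ X ψ a (cur ++ [ d ]) (rfStep X φ cur best)) cd)

module Semantics {Φ Λ : Set} (_≟_ : DecidableEquality Λ) (M : Kripke Φ) (Ω : OrdinalsUpTo) where
  open Kripke M
  open OrdinalsUpTo Ω
  open IsStrictTotalOrder isSTO using (compare) renaming (trans to <-trans)

  Asg : Set₁
  Asg = Assignment _≟_ M Ω

  ⟦_⟧ : Fm Φ Λ → Asg → W → Set
  ⟦_⟧ = sat _≟_ M Ω

  _⟨_/_⟩ : Asg → (W → Set) → Λ → Asg
  _⟨_/_⟩ = _[_/_] _≟_ M Ω

  Predecessor : Ord → Ord → Set
  Predecessor = IsPred _≟_ M Ω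

  Limit : Ord → Set
  Limit = IsLimit _≟_ M Ω

  Aμ Aν : ((W → Set) → W → Set) → (γ : Ord) → Acc _<_ γ → W → Set
  Aμ = approxμ _≟_ M Ω
  Aν = approxν _≟_ M Ω

  Approx : Kind → ((W → Set) → W → Set) → Ord → W → Set
  Approx μK F γ = Aμ F γ (wf γ)
  Approx νK F γ = Aν F γ (wf γ)

  ⟨/⟩-same : ∀ (s : Asg) A X → (s ⟨ A / X ⟩) X ≡ A
  ⟨/⟩-same s A X = if-true (dec-true (X ≟ X) refl)

  ⟨/⟩-other : ∀ (s : Asg) A {X Y} → Y ≢ X → (s ⟨ A / X ⟩) Y ≡ s Y
  ⟨/⟩-other s A {X} {Y} Y≢X = if-false (dec-false (Y ≟ X) Y≢X)

  infix 4 _⊆_ _⊑_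

  _⊆_ : (W → Set) → (W → Set) → Set
  A ⊆ B = ∀ {w} → A w → B w

  Monotone : ((W → Set) → W → Set) → Set₁
  Monotone F = ∀ {A B} → A ⊆ B → F A ⊆ F B

  _⊑_ : Asg → Asg → Set
  s ⊑ s′ = ∀ X → s X ⊆ s′ X

  ⊑-refl : ∀ {s} → s ⊑ s
  ⊑-refl _ x = x

  ⟨/⟩-mono : ∀ {s s′ : Asg} {A B} X → s ⊑ s′ → A ⊆ B → s ⟨ A / X ⟩ ⊑ s′ ⟨ B / X ⟩
  ⟨/⟩-mono X s⊑s′ A⊆B Y with does (Y ≟ X)
  ... | true  = A⊆B
  ... | false = s⊑s′ Y

  approxμ-mono : ∀ {F G} → (∀ A → F A ⊆ G A) → Monotone G → ∀ γ (p : Acc _<_ γ) → Aμ F γ p ⊆ Aμ G γ p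
  approxμ-mono F⊆G G-mono γ (acc rs) (inj₁ (δ , δ-pred , x)) =
    inj₁ (δ , δ-pred , G-mono (approxμ-mono F⊆G G-mono δ (rs (proj₁ δ-pred))) (F⊆G _ x))
  approxμ-mono F⊆G G-mono γ (acc rs) (inj₂ (lim , δ , δ<γ , x)) =
    inj₂ (lim , δ , δ<γ , approxμ-mono F⊆G G-mono δ (rs δ<γ) x)

  approxν-mono : ∀ {F G} → (∀ A → F A ⊆ G A) → Monotone G → ∀ γ (p : Acc _<_ γ) → Aν F γ p ⊆ Aν G γ p
  approxν-mono F⊆G G-mono γ (acc rs) (inj₁ (δ , δ-pred , x)) =
    inj₁ (δ , δ-pred , G-mono (approxν-mono F⊆G G-mono δ (rs (proj₁ δ-pred))) (F⊆G _ x))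
  approxν-mono F⊆G G-mono γ (acc rs) (inj₂ (lim , h)) =
    inj₂ (lim , λ δ δ<γ → approxν-mono F⊆G G-mono δ (rs δ<γ) (h δ δ<γ))

  ⟦⟧-mono-in : ∀ φ s X → Monotone (λ A → ⟦ φ ⟧ (s ⟨ A / X ⟩))

  ⟦⟧-mono : ∀ φ {s s′} → s ⊑ s′ → ⟦ φ ⟧ s ⊆ ⟦ φ ⟧ s′
  ⟦⟧-mono (prop _)  _    x           = x
  ⟦⟧-mono (nprop _) _    x           = x
  ⟦⟧-mono (var X)   s⊑s′ x           = s⊑s′ X x
  ⟦⟧-mono (φ ⋁ _)   s⊑s′ (inj₁ x)    = inj₁ (⟦⟧-mono φ s⊑s′ x)
  ⟦⟧-mono (_ ⋁ ψ)   s⊑s′ (inj₂ y)    = inj₂ (⟦⟧-mono ψ s⊑s′ y)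
  ⟦⟧-mono (φ ⋀ ψ)   s⊑s′ (x , y)     = ⟦⟧-mono φ s⊑s′ x , ⟦⟧-mono ψ s⊑s′ y
  ⟦⟧-mono (◇ φ)     s⊑s′ (v , r , x) = v , r , ⟦⟧-mono φ s⊑s′ x
  ⟦⟧-mono (□ φ)     s⊑s′ h           = λ v r → ⟦⟧-mono φ s⊑s′ (h v r)
  ⟦⟧-mono (μ X φ) {s′ = s′} s⊑s′ =
    approxμ-mono (λ _ → ⟦⟧-mono φ (⟨/⟩-mono X s⊑s′ λ x → x)) (⟦⟧-mono-in φ s′ X) Γ (wf Γ)
  ⟦⟧-mono (ν X φ) {s′ = s′} s⊑s′ =
    approxν-mono (λ _ → ⟦⟧-mono φ (⟨/⟩-mono X s⊑s′ λ x → x)) (⟦⟧-mono-in φ s′ X) Γ (wf Γ)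

  ⟦⟧-mono-in φ s X A⊆B = ⟦⟧-mono φ (⟨/⟩-mono X ⊑-refl A⊆B)

  predecessor-≤ : ∀ {δ₀ γ δ} → Predecessor δ₀ γ → δ < γ → δ ≡ δ₀ ⊎ δ < δ₀
  predecessor-≤ {δ₀} {δ = δ} (_ , nothing-between) δ<γ with compare δ δ₀
  ... | tri< δ<δ₀ _ _ = inj₂ δ<δ₀
  ... | tri≈ _ δ≡δ₀ _ = inj₁ δ≡δ₀
  ... | tri> _ _ δ₀<δ = ⊥-elim (nothing-between δ δ₀<δ δ<γ)

  module _ {F : (W → Set) → W → Set} (F-mono : Monotone F) where

    approxμ-irr : ∀ γ (p q : Acc _<_ γ) → Aμ F γ p ⊆ Aμ F γ q
    approxμ-irr γ (acc rs) (acc qs) (inj₁ (δ , δ-pred , x)) =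
      inj₁ (δ , δ-pred , F-mono (approxμ-irr δ (rs (proj₁ δ-pred)) (qs (proj₁ δ-pred))) x)
    approxμ-irr γ (acc rs) (acc qs) (inj₂ (lim , δ , δ<γ , x)) =
      inj₂ (lim , δ , δ<γ , approxμ-irr δ (rs δ<γ) (qs δ<γ) x)

    approxν-irr : ∀ γ (p q : Acc _<_ γ) → Aν F γ p ⊆ Aν F γ q
    approxν-irr γ (acc rs) (acc qs) (inj₁ (δ , δ-pred , x)) =
      inj₁ (δ , δ-pred , F-mono (approxν-irr δ (rs (proj₁ δ-pred)) (qs (proj₁ δ-pred))) x)
    approxν-irr γ (acc rs) (acc qs) (inj₂ (lim , h)) =
      inj₂ (lim , λ δ δ<γ → approxν-irr δ (rs δ<γ) (qs δ<γ) (h δ δ<γ))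

    approxμ-elim : ∀ γ (p : Acc _<_ γ) {w} → Aμ F γ p w → ∃[ δ ] δ < γ × F (Approx μK F δ) w
    approxμ-elim γ (acc rs) (inj₁ (δ , (δ<γ , _) , x)) =
      δ , δ<γ , F-mono (approxμ-irr δ (rs δ<γ) (wf δ)) x
    approxμ-elim γ (acc rs) (inj₂ (_ , δ , δ<γ , x)) =
      let (ε , ε<δ , y) = approxμ-elim δ (rs δ<γ) x in ε , <-trans ε<δ δ<γ , y

    approxμ-succ : ∀ ε (q : Acc _<_ ε) {δ w} → Predecessor δ ε → F (Approx μK F δ) w → Aμ F ε q w
    approxμ-succ ε (acc qs) {δ} δ-pred x =
      inj₁ (δ , δ-pred , F-mono (approxμ-irr δ (wf δ) (qs (proj₁ δ-pred))) x)

  module Classical (lem : ∀ {ℓ} → ExcludedMiddle ℓ) where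

    successor≤ : ∀ γ → Acc _<_ γ → ∀ {δ} → δ < γ → ∃[ ε ] Predecessor δ ε × (ε < γ ⊎ ε ≡ γ)
    successor≤ γ (acc rs) {δ} δ<γ with lem {P = ∃[ ε ] δ < ε × ε < γ}
    ... | no ∄ε = γ , (δ<γ , λ ε δ<ε ε<γ → ∄ε (ε , δ<ε , ε<γ)) , inj₂ refl
    ... | yes (ε , δ<ε , ε<γ) with successor≤ ε (rs ε<γ) δ<ε
    ...   | ε′ , δ-pred , inj₁ ε′<ε = ε′ , δ-pred , inj₁ (<-trans ε′<ε ε<γ)
    ...   | ε′ , δ-pred , inj₂ refl = ε′ , δ-pred , inj₁ ε<γ

    successor<limit : ∀ {γ δ} → Limit γ → δ < γ → ∃[ ε ] Predecessor δ ε × ε < γ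
    successor<limit {γ} lim δ<γ with successor≤ γ (wf γ) δ<γ
    ... | ε , δ-pred , inj₁ ε<γ = ε , δ-pred , ε<γ
    ... | _ , δ-pred , inj₂ refl = ⊥-elim (lim (_ , δ-pred))

    module _ {F : (W → Set) → W → Set} (F-mono : Monotone F) where

      approxμ-intro : ∀ γ (p : Acc _<_ γ) {δ w} → δ < γ → F (Approx μK F δ) w → Aμ F γ p w
      approxμ-intro γ (acc rs) {δ} δ<γ x with lem {P = ∃[ δ₀ ] Predecessor δ₀ γ}
      ... | yes (δ₀ , δ₀-pred) = inj₁ (δ₀ , δ₀-pred , F-mono stage-δ⊆δ₀ x)
        where
          stage-δ⊆δ₀ : Approx μK F δ ⊆ Aμ F δ₀ (rs (proj₁ δ₀-pred))
          stage-δ⊆δ₀ with predecessor-≤ δ₀-pred δ<γ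
          ... | inj₁ refl = approxμ-irr F-mono δ (wf δ) (rs (proj₁ δ₀-pred))
          ... | inj₂ δ<δ₀ = λ y →
            let (ε , ε<δ , z) = approxμ-elim F-mono δ (wf δ) y
            in approxμ-intro δ₀ (rs (proj₁ δ₀-pred)) (<-trans ε<δ δ<δ₀) z
      ... | no lim =
        let (ε , δ-pred , ε<γ) = successor<limit lim δ<γ
        in inj₂ (lim , ε , ε<γ , approxμ-succ F-mono ε (rs ε<γ) δ-pred x)

      approxν-intro : ∀ γ (p : Acc _<_ γ) {w} → (∀ {δ} → δ < γ → F (Approx νK F δ) w) → Aν F γ p w
      approxν-intro γ (acc rs) h with lem {P = ∃[ δ₀ ] Predecessor δ₀ γ}
      ... | yes (δ₀ , δ₀-pred) =
        inj₁ (δ₀ , δ₀-pred , F-mono (approxν-irr F-mono δ₀ (wf δ₀) (rs (proj₁ δ₀-pred))) (h (proj₁ δ₀-pred)))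
      ... | no lim = inj₂ (lim , λ δ δ<γ → approxν-intro δ (rs δ<γ) λ ε<δ → h (<-trans ε<δ δ<γ))

      approxν-elim : ∀ γ (p : Acc _<_ γ) {w} → Aν F γ p w → ∀ {δ} → δ < γ → F (Approx νK F δ) w
      approxν-elim γ (acc rs) (inj₁ (δ₀ , δ₀-pred , x)) {δ} δ<γ = F-mono stage-δ₀⊆δ x
        where
          stage-δ₀⊆δ : Aν F δ₀ (rs (proj₁ δ₀-pred)) ⊆ Approx νK F δ
          stage-δ₀⊆δ with predecessor-≤ δ₀-pred δ<γ
          ... | inj₁ refl = approxν-irr F-mono δ (rs (proj₁ δ₀-pred)) (wf δ)
          ... | inj₂ δ<δ₀ = λ y →
            approxν-intro δ (wf δ) λ ε<δ → approxν-elim δ₀ (rs (proj₁ δ₀-pred)) y (<-trans ε<δ δ<δ₀)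
      approxν-elim γ (acc rs) (inj₂ (lim , h)) δ<γ =
        let (ε , δ-pred , ε<γ) = successor<limit lim δ<γ
        in approxν-elim ε (rs ε<γ) (h ε ε<γ) (proj₁ δ-pred)

module Correspondence (lem : ∀ {ℓ} → ExcludedMiddle ℓ) {Φ Λ : Set} (_≟_ : DecidableEquality Λ)
                      (M : Kripke Φ) (Ω : OrdinalsUpTo) (Γ>0 : Positive Ω) (φ₀ : Fm Φ Λ) where
  open Kripke M
  open OrdinalsUpTo Ω
  open Navigation {Φ = Φ} _≟_
  open Semantics _≟_ M Ω
  open Classical lem
  open Game _≟_ M Ω φ₀
  open Strategy
  open ≡-Reasoning

  enter : Fm Φ Λ → Ord → Asg → Asg
  enter (μ Y ψ) γ s = s ⟨ Approx μK (λ A → ⟦ ψ ⟧ (s ⟨ A / Y ⟩)) γ / Y ⟩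
  enter (ν Y ψ) γ s = s ⟨ Approx νK (λ A → ⟦ ψ ⟧ (s ⟨ A / Y ⟩)) γ / Y ⟩
  enter _       _ s = s

  enter-binder : ∀ k {Y ψ γ s} → enter (binder k Y ψ) γ s ≡ s ⟨ Approx k (λ A → ⟦ ψ ⟧ (s ⟨ A / Y ⟩)) γ / Y ⟩
  enter-binder μK = refl
  enter-binder νK = refl

  enter-same : ∀ k {X ψ γ s} → enter (binder k X ψ) γ s X ≡ Approx k (λ A → ⟦ ψ ⟧ (s ⟨ A / X ⟩)) γ
  enter-same k {X} {s = s} = trans (cong (λ s′ → s′ X) (enter-binder k)) (⟨/⟩-same s _ X)

  enter-other : ∀ k {X Y ψ γ s} → X ≢ Y → enter (binder k Y ψ) γ s X ≡ s X
  enter-other k {X} {s = s} X≢Y = trans (cong (λ s′ → s′ X) (enter-binder k)) (⟨/⟩-other s _ X≢Y)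

  -- env c a binds the label of every binder b on the path to a to its
  -- approximant of stage c b.
  envFrom : Counter → Fm Φ Λ → List Dir → List Dir → Asg → Asg
  envFrom c φ []      cur s = s
  envFrom c φ (d ∷ a) cur s = maybe′ (λ ψ → envFrom c ψ a (cur ++ [ d ]) (enter φ (c cur) s)) s (child φ d)

  env : Counter → List Dir → Asg
  env c a = envFrom c φ₀ a [] (λ _ _ → ⊥)

  Body : Counter → List Dir → Λ → Fm Φ Λ → (W → Set) → W → Set
  Body c b X ψ A = ⟦ ψ ⟧ (env c b ⟨ A / X ⟩)

  Body-mono : ∀ c b X ψ → Monotone (Body c b X ψ)
  Body-mono c b X ψ = ⟦⟧-mono-in ψ (env c b) X

  envFrom-∷ : ∀ {c φ d ψ} a cur s → child φ d ≡ just ψ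
            → envFrom c φ (d ∷ a) cur s ≡ envFrom c ψ a (cur ++ [ d ]) (enter φ (c cur) s)
  envFrom-∷ a cur s cd rewrite cd = refl

  envFrom-child : ∀ {c χ d ψ} φ a cur s → at φ a ≡ just χ → child χ d ≡ just ψ
                → envFrom c φ (a ++ [ d ]) cur s ≡ enter χ (c (cur ++ a)) (envFrom c φ a cur s)
  envFrom-child φ [] cur s refl cd rewrite cd | ++-identityʳ cur = refl
  envFrom-child {c} {χ} {d} φ (e ∷ a) cur s h cd =
    let (φ′ , ce , h′) = at-∷⁻¹ φ e a h in
    begin
      envFrom c φ (e ∷ a ++ [ d ]) cur s
        ≡⟨ envFrom-∷ (a ++ [ d ]) cur s ce ⟩
      envFrom c φ′ (a ++ [ d ]) (cur ++ [ e ]) (enter φ (c cur) s)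
        ≡⟨ envFrom-child φ′ a (cur ++ [ e ]) _ h′ cd ⟩
      enter χ (c ((cur ++ [ e ]) ++ a)) (envFrom c φ′ a (cur ++ [ e ]) (enter φ (c cur) s))
        ≡⟨ cong₂ (λ b s′ → enter χ (c b) s′) (++-assoc cur [ e ] a) (sym (envFrom-∷ a cur s ce)) ⟩
      enter χ (c (cur ++ e ∷ a)) (envFrom c φ (e ∷ a) cur s)
    ∎

  env-child : ∀ {c} a {χ d ψ} → at φ₀ a ≡ just χ → child χ d ≡ just ψ
            → env c (a ++ [ d ]) ≡ enter χ (c a) (env c a)
  env-child a h cd = envFrom-child φ₀ a [] _ h cd

  infix 4 _≈[_]_ _≈_[_↦_]

  _≈[_]_ : Counter → List Dir → Counter → Set
  c ≈[ a ] c′ = ∀ {e} → e ⊏ a → c e ≡ c′ e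

  _≈_[_↦_] : Counter → Counter → List Dir → Ord → Set
  c′ ≈ c [ b ↦ γ ] = c′ ≈[ b ] c × c′ b ≡ γ

  ≈-trans : ∀ {a c₁ c₂ c₃} → c₁ ≈[ a ] c₂ → c₂ ≈[ a ] c₃ → c₁ ≈[ a ] c₃
  ≈-trans c₁≈c₂ c₂≈c₃ e⊏a = trans (c₁≈c₂ e⊏a) (c₂≈c₃ e⊏a)

  ≈-restrict : ∀ {a b c₁ c₂} → b ⊏ a → c₁ ≈[ a ] c₂ → c₁ ≈[ b ] c₂
  ≈-restrict b⊏a c₁≈c₂ e⊏b = c₁≈c₂ (⊏-trans e⊏b b⊏a)

  setC-↦ : ∀ {c b γ} → setC c b γ ≈ c [ b ↦ γ ]
  setC-↦ {b = b} = (λ e⊏b → if-false (eqAddr-⊏ e⊏b)) , if-true (eqAddr-refl b)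

  resetC-↦ : ∀ {c b γ} → resetC c b γ ≈ c [ b ↦ γ ]
  resetC-↦ {b = b} =
    (λ e⊏b → trans (if-false (eqAddr-⊏ e⊏b)) (if-false (isPrefix-⊏ e⊏b))) , if-true (eqAddr-refl b)

  envFrom-≈ : ∀ {c c′} φ a cur s → (λ e → c (cur ++ e)) ≈[ a ] (λ e → c′ (cur ++ e))
            → envFrom c φ a cur s ≡ envFrom c′ φ a cur s
  envFrom-≈ φ [] cur s _ = refl
  envFrom-≈ {c} {c′} φ (d ∷ a) cur s agree with child φ d
  ... | nothing = refl
  ... | just ψ  = begin
      envFrom c ψ a (cur ++ [ d ]) (enter φ (c cur) s)
        ≡⟨ cong (λ γ → envFrom c ψ a (cur ++ [ d ]) (enter φ γ s)) c≡c′-at-cur ⟩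
      envFrom c ψ a (cur ++ [ d ]) (enter φ (c′ cur) s)
        ≡⟨ envFrom-≈ ψ a (cur ++ [ d ]) _ agree-below ⟩
      envFrom c′ ψ a (cur ++ [ d ]) (enter φ (c′ cur) s)
    ∎
    where
      c≡c′-at-cur : c cur ≡ c′ cur
      c≡c′-at-cur = subst (λ b → c b ≡ c′ b) (++-identityʳ cur) (agree []⊏∷)
      agree-below : (λ e → c ((cur ++ [ d ]) ++ e)) ≈[ a ] (λ e → c′ ((cur ++ [ d ]) ++ e))
      agree-below {e} e⊏a = subst (λ b → c b ≡ c′ b) (sym (++-assoc cur [ d ] e)) (agree (∷⊏∷ e⊏a))

  env-≈ : ∀ {c c′ a} → c ≈[ a ] c′ → env c a ≡ env c′ a
  env-≈ {a = a} agree = envFrom-≈ φ₀ a [] _ agree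

  Binding : Counter → List Dir → Λ → Maybe (Kind × List Dir) → (W → Set) → Set₁
  Binding c a X nothing        S = S ≡ (λ _ → ⊥)
  Binding c a X (just (k , b)) S =
    Σ[ ψ ∈ Fm Φ Λ ] at φ₀ b ≡ just (binder k X ψ) × b ⊏ a × S ≡ Approx k (Body c b X ψ) (c b)

  Binding-∷ʳ : ∀ {c a X d} m {S} → Binding c a X m S → Binding c (a ++ [ d ]) X m S
  Binding-∷ʳ nothing  S≡∅                 = S≡∅
  Binding-∷ʳ (just _) (ψ , eb , b⊏a , S≡) = ψ , eb , ⊏-∷ʳ b⊏a , S≡

  Binding-enter : ∀ {c cur X best d} k {Y ψ} → at φ₀ cur ≡ just (binder k Y ψ) → (Y≟X : Dec (Y ≡ X))
                → Binding c cur X best (env c cur X)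
                → Binding c (cur ++ [ d ]) X (if does Y≟X then just (k , cur) else best)
                          (enter (binder k Y ψ) (c cur) (env c cur) X)
  Binding-enter {cur = cur} k {ψ = ψ} e (yes refl) _ = ψ , e , xs⊏xs∷ʳx cur , enter-same k
  Binding-enter {best = best} k e (no Y≢X) i =
    subst (Binding _ _ _ best) (sym (enter-other k (≢-sym Y≢X))) (Binding-∷ʳ best i)

  Binding-step : ∀ {c cur X best d} φ → at φ₀ cur ≡ just φ → Binding c cur X best (env c cur X)
               → Binding c (cur ++ [ d ]) X (rfStep X φ cur best) (enter φ (c cur) (env c cur) X)
  Binding-step {best = best} (prop _)  _ = Binding-∷ʳ best
  Binding-step {best = best} (nprop _) _ = Binding-∷ʳ best
  Binding-step {best = best} (var _)   _ = Binding-∷ʳ best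
  Binding-step {best = best} (_ ⋁ _)   _ = Binding-∷ʳ best
  Binding-step {best = best} (_ ⋀ _)   _ = Binding-∷ʳ best
  Binding-step {best = best} (◇ _)     _ = Binding-∷ʳ best
  Binding-step {best = best} (□ _)     _ = Binding-∷ʳ best
  Binding-step {X = X} (μ Y _) e = Binding-enter μK e (Y ≟ X)
  Binding-step {X = X} (ν Y _) e = Binding-enter νK e (Y ≟ X)

  Binding-from : ∀ {c X χ} φ a cur best → at φ₀ cur ≡ just φ → at φ a ≡ just χ
               → Binding c cur X best (env c cur X)
               → Binding c (cur ++ a) X (rfGo _≟_ X φ a cur best) (env c (cur ++ a) X)
  Binding-from {c} {X} φ [] cur best _ _ i =
    subst (λ a → Binding c a X best (env c a X)) (sym (++-identityʳ cur)) i
  Binding-from {c} {X} φ (d ∷ a) cur best e h i =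
    let (ψ , cd , h′) = at-∷⁻¹ φ d a h
        i′ = subst (λ s → Binding c (cur ++ [ d ]) X (rfStep X φ cur best) (s X))
                   (sym (env-child cur e cd)) (Binding-step φ e i)
    in subst₂ (λ a′ m → Binding c a′ X m (env c a′ X))
              (++-assoc cur [ d ] a) (sym (rfGo-∷-child a cur best cd))
              (Binding-from ψ a (cur ++ [ d ]) _ (at-child φ₀ cur e cd) h′ i′)

  binding : ∀ {c a X χ m} → at φ₀ a ≡ just χ → rf _≟_ φ₀ a X ≡ m → Binding c a X m (env c a X)
  binding {a = a} h refl = Binding-from φ₀ a [] nothing refl h refl

  data Holds (c : Counter) (a : List Dir) (w : W) : Set where
    holds-at : ∀ {χ} → at φ₀ a ≡ just χ → ⟦ χ ⟧ (env c a) w → Holds c a w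

  holds : ∀ {c a χ w} → at φ₀ a ≡ just χ → Holds c a w → ⟦ χ ⟧ (env c a) w
  holds e (holds-at e′ x) with refl ← trans (sym e) e′ = x

  Holds⇔ : ∀ {c a χ w} {S : W → Set} → at φ₀ a ≡ just χ → ⟦ χ ⟧ (env c a) ≡ S → Holds c a w ⇔ S w
  Holds⇔ e refl = mk⇔ (holds e) (holds-at e)

  Holds-child : ∀ {c} a d {χ ψ w} → at φ₀ a ≡ just χ → child χ d ≡ just ψ
              → Holds c (a ++ [ d ]) w ⇔ ⟦ ψ ⟧ (enter χ (c a) (env c a)) w
  Holds-child a d {ψ = ψ} e cd = Holds⇔ (at-child φ₀ a e cd) (cong ⟦ ψ ⟧ (env-child a e cd))

  env-body : ∀ k {c c′ b X ψ γ} → at φ₀ b ≡ just (binder k X ψ) → c′ ≈ c [ b ↦ γ ]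
           → env c′ (b ++ [ down ]) ≡ env c b ⟨ Approx k (Body c b X ψ) γ / X ⟩
  env-body k {c} {c′} {b} {X} {ψ} e (c′≈c , c′b≡γ) = begin
      env c′ (b ++ [ down ])
        ≡⟨ env-child b e (child-binder k) ⟩
      enter (binder k X ψ) (c′ b) (env c′ b)
        ≡⟨ enter-binder k ⟩
      env c′ b ⟨ Approx k (Body c′ b X ψ) (c′ b) / X ⟩
        ≡⟨ cong₂ (λ s γ → s ⟨ Approx k (λ A → ⟦ ψ ⟧ (s ⟨ A / X ⟩)) γ / X ⟩) (env-≈ c′≈c) c′b≡γ ⟩
      env c b ⟨ Approx k (Body c b X ψ) _ / X ⟩
    ∎

  Holds-body : ∀ k {c c′} b {X ψ γ w} → at φ₀ b ≡ just (binder k X ψ) → c′ ≈ c [ b ↦ γ ]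
             → Holds c′ (b ++ [ down ]) w ⇔ Body c b X ψ (Approx k (Body c b X ψ) γ) w
  Holds-body k b {ψ = ψ} e c′↦ = Holds⇔ (at-child φ₀ b e (child-binder k)) (cong ⟦ ψ ⟧ (env-body k e c′↦))

  Holds-var : ∀ {c a X k b w} → at φ₀ a ≡ just (var X) → rf _≟_ φ₀ a X ≡ just (k , b)
            → Σ[ ψ ∈ Fm Φ Λ ] at φ₀ b ≡ just (binder k X ψ) × b ⊏ a
                              × (Holds c a w ⇔ Approx k (Body c b X ψ) (c b) w)
  Holds-var {c} {a} {X} e f = let (ψ , eb , b⊏a , S≡) = binding e f in ψ , eb , b⊏a , Holds⇔ e S≡

  σ : Strategy
  σ = record
    { orS  = λ w a c {ψ} _ → does (lem {P = ⟦ ψ ⟧ (env c a) w})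
    ; diaS = λ w a c {ψ} _ → pickOrRefute (lem {P = ∃[ v ] R w v × ⟦ ψ ⟧ (env c a) v}) lem
    ; muS  = λ w a c _ → pick (lem {P = ∃[ γ ] γ < Γ × Holds (setC c a γ) (a ++ [ down ]) w}) Γ>0
    ; varS = λ w a c {b = b} _ _ →
        pickOrRefute (lem {P = ∃[ γ ] γ < c b × Holds (resetC c b γ) (b ++ [ down ]) w}) lem
    }

  Wins-body : List Dir → Ord → Counter → Set
  Wins-body b γ c =
    ∀ {c′} → c′ ≈ c [ b ↦ γ ] → ∀ {w} → Holds c′ (b ++ [ down ]) w → Wins σ w (b ++ [ down ]) c′

  Wins-body-≈ : ∀ {b γ c₁ c₂} → c₁ ≈[ b ] c₂ → Wins-body b γ c₂ → Wins-body b γ c₁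
  Wins-body-≈ c₁≈c₂ win (c′≈c₁ , c′b≡γ) = win (≈-trans c′≈c₁ c₁≈c₂ , c′b≡γ)

  -- Induction hypothesis for the regeneration moves available below a.
  Hyp : List Dir → Counter → Set
  Hyp a c = ∀ {b} → b ⊏ a → IsBinder (at φ₀ b) → ∀ {γ} → γ < c b → Wins-body b γ c

  IsBinder-at : ∀ k b {X ψ} → at φ₀ b ≡ just (binder k X ψ) → IsBinder (at φ₀ b)
  IsBinder-at k b eb = subst IsBinder (sym eb) (IsBinder-binder k)

  Hyp-child : ∀ {a c χ d} → at φ₀ a ≡ just χ → ¬ IsBinder (just χ) → Hyp a c → Hyp (a ++ [ d ]) c
  Hyp-child {a} e not-binder h b⊏ isBinder with ⊏-∷ʳ⁻¹ a b⊏
  ... | inj₁ refl = ⊥-elim (not-binder (subst IsBinder e isBinder))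
  ... | inj₂ b⊏a  = h b⊏a isBinder

  Complete : Fm Φ Λ → Set
  Complete χ = ∀ {a c} → at φ₀ a ≡ just χ → Hyp a c → ∀ {w} → Holds c a w → Wins σ w a c

  body-wins : ∀ {ψ a c} → Complete ψ → at φ₀ (a ++ [ down ]) ≡ just ψ → Hyp a c
            → ∀ γ → Acc _<_ γ → Wins-body a γ c
  body-wins {a = a} IH e h γ (acc rs) {c′} (c′≈c , c′a≡γ) t = IH e hyp′ t
    where
      hyp′ : Hyp (a ++ [ down ]) c′
      hyp′ b⊏ isBinder γ′< with ⊏-∷ʳ⁻¹ a b⊏
      ... | inj₁ refl = Wins-body-≈ c′≈c (body-wins IH e h _ (rs (subst (_ <_) c′a≡γ γ′<)))
      ... | inj₂ b⊏a  = Wins-body-≈ (≈-restrict b⊏a c′≈c) (h b⊏a isBinder (subst (_ <_) (c′≈c b⊏a) γ′<))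

  descend : ∀ {χ ψ c w} → Complete ψ → ∀ a d → at φ₀ a ≡ just χ → ¬ IsBinder (just χ) → child χ d ≡ just ψ
          → Hyp a c → ⟦ ψ ⟧ (enter χ (c a) (env c a)) w → Wins σ w (a ++ [ d ]) c
  descend IH a d e not-binder cd h x =
    IH (at-child φ₀ a e cd) (Hyp-child e not-binder h) (from (Holds-child a d e cd) x)

  complete-⋁ : ∀ {ψ θ} → Complete ψ → Complete θ → Complete (ψ ⋁ θ)
  complete-⋁ {ψ} {θ} IHψ IHθ {a} {c} e h {w} t = wOr e (by-choice (lem {P = ⟦ ψ ⟧ (env c a) w}) (holds e t))
    where
      by-choice : (d : Dec (⟦ ψ ⟧ (env c a) w)) → ⟦ ψ ⋁ θ ⟧ (env c a) w
                → Wins σ w (a ++ [ if does d then left else right ]) c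
      by-choice (yes x) _        = descend IHψ a left e (λ ()) refl h x
      by-choice (no ¬x) (inj₁ x) = ⊥-elim (¬x x)
      by-choice (no _)  (inj₂ y) = descend IHθ a right e (λ ()) refl h y

  complete-⋀ : ∀ {ψ θ} → Complete ψ → Complete θ → Complete (ψ ⋀ θ)
  complete-⋀ IHψ IHθ {a} e h t =
    let (x , y) = holds e t
    in wAnd e (descend IHψ a left e (λ ()) refl h x) (descend IHθ a right e (λ ()) refl h y)

  complete-◇ : ∀ {ψ} → Complete ψ → Complete (◇ ψ)
  complete-◇ {ψ} IH {a} {c} e h {w} t =
    let ((v , r) , chosen , x) =
          pickOrRefute-spec (lem {P = ∃[ v ] R w v × ⟦ ψ ⟧ (env c a) v}) lem (holds e t)
    in wDia e v r chosen (descend IH a down e (λ ()) refl h x)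

  complete-□ : ∀ {ψ} → Complete ψ → Complete (□ ψ)
  complete-□ IH {a} e h t = wBox e λ v r → descend IH a down e (λ ()) refl h (holds e t v r)

  complete-μ : ∀ {X ψ} → Complete ψ → Complete (μ X ψ)
  complete-μ {X} {ψ} IH {a} {c} e h {w} t =
    let (δ , δ<Γ , x) = approxμ-elim (Body-mono c a X ψ) Γ (wf Γ) (holds e t)
        chosen = pick-spec (lem {P = ∃[ γ ] γ < Γ × Holds (setC c a γ) (a ++ [ down ]) w}) Γ>0
                           (δ , δ<Γ , from (Holds-body μK a e setC-↦) x)
    in wMu e (body-wins IH (at-child φ₀ a e refl) h _ (wf _) setC-↦ chosen)

  complete-ν : ∀ {X ψ} → Complete ψ → Complete (ν X ψ)
  complete-ν {X} {ψ} IH {a} {c} e h t = wNu e λ γ γ<Γ →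
    body-wins IH (at-child φ₀ a e refl) h γ (wf γ) setC-↦
      (from (Holds-body νK a e setC-↦) (approxν-elim (Body-mono c a X ψ) Γ (wf Γ) (holds e t) γ<Γ))

  complete-var : ∀ {X} → Complete (var X)
  complete-var {X} {a} {c} e h {w} t with rf _≟_ φ₀ a X in f
  ... | nothing = ⊥-elim (to (Holds⇔ e (binding {c = c} {a} {X} e f)) t)
  ... | just (μK , b) =
    let (ψ , eb , b⊏a , t⇔) = Holds-var e f
        (δ , δ<cb , x) = approxμ-elim (Body-mono c b X ψ) (c b) (wf (c b)) (to t⇔ t)
        ((γ , γ<cb) , chosen , t′) =
          pickOrRefute-spec (lem {P = ∃[ γ ] γ < c b × Holds (resetC c b γ) (b ++ [ down ]) w}) lem
                            (δ , δ<cb , from (Holds-body μK b eb resetC-↦) x)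
    in wVarμ e f γ γ<cb chosen (h b⊏a (IsBinder-at μK b eb) γ<cb resetC-↦ t′)
  ... | just (νK , b) =
    let (ψ , eb , b⊏a , t⇔) = Holds-var e f
    in wVarν e f λ γ γ<cb → h b⊏a (IsBinder-at νK b eb) γ<cb resetC-↦
         (from (Holds-body νK b eb resetC-↦)
           (approxν-elim (Body-mono c b X ψ) (c b) (wf (c b)) (to t⇔ t) γ<cb))

  complete : ∀ χ → Complete χ
  complete (prop _)  e _ t = wProp e (holds e t)
  complete (nprop _) e _ t = wNProp e (holds e t)
  complete (var _)         = complete-var
  complete (ψ ⋁ θ)         = complete-⋁ (complete ψ) (complete θ)
  complete (ψ ⋀ θ)         = complete-⋀ (complete ψ) (complete θ)
  complete (◇ ψ)           = complete-◇ (complete ψ)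
  complete (□ ψ)           = complete-□ (complete ψ)
  complete (μ _ ψ)         = complete-μ (complete ψ)
  complete (ν _ ψ)         = complete-ν (complete ψ)

  sound : ∀ {τ w a c} → Wins τ w a c → Holds c a w
  sound (wProp e v)   = holds-at e v
  sound (wNProp e ¬v) = holds-at e ¬v
  sound {τ} {w} {a} {c} (wOr {ψ = ψ} {θ} e won) = holds-at e (by-choice (orS τ w a c e) (sound won))
    where
      by-choice : ∀ b → Holds c (a ++ [ if b then left else right ]) w → ⟦ ψ ⋁ θ ⟧ (env c a) w
      by-choice true  t = inj₁ (to (Holds-child a left e refl) t)
      by-choice false t = inj₂ (to (Holds-child a right e refl) t)
  sound {a = a} (wAnd e won₁ won₂) =
    holds-at e (to (Holds-child a left e refl) (sound won₁) , to (Holds-child a right e refl) (sound won₂))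
  sound {a = a} (wDia e v r _ won) = holds-at e (v , r , to (Holds-child a down e refl) (sound won))
  sound {a = a} (wBox e won)       = holds-at e (λ v r → to (Holds-child a down e refl) (sound (won v r)))
  sound {τ} {w} {a} {c} (wMu {X = X} {ψ} e won) =
    holds-at e (approxμ-intro (Body-mono c a X ψ) Γ (wf Γ) (proj₂ (muS τ w a c e))
                 (to (Holds-body μK a e setC-↦) (sound won)))
  sound {a = a} {c = c} (wNu {X = X} {ψ} e won) =
    holds-at e (approxν-intro (Body-mono c a X ψ) Γ (wf Γ) λ γ<Γ →
                 to (Holds-body νK a e setC-↦) (sound (won _ γ<Γ)))
  sound {c = c} (wVarμ {X = X} {b} e f _ γ<cb _ won) =
    let (ψ , eb , _ , t⇔) = Holds-var e f
    in from t⇔ (approxμ-intro (Body-mono c b X ψ) (c b) (wf (c b)) γ<cb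
                  (to (Holds-body μK b eb resetC-↦) (sound won)))
  sound {c = c} (wVarν {X = X} {b} e f won) =
    let (ψ , eb , _ , t⇔) = Holds-var e f
    in from t⇔ (approxν-intro (Body-mono c b X ψ) (c b) (wf (c b)) λ γ<cb →
                  to (Holds-body νK b eb resetC-↦) (sound (won _ γ<cb)))

theorem11 : (lem : ∀ {ℓ} → ExcludedMiddle ℓ)
    → {Φ Λ : Set} (_≟_ : DecidableEquality Λ)
    → (M : Kripke Φ) (Ω : OrdinalsUpTo) → Positive Ω
    → (w₀ : Kripke.W M) (φ₀ : Fm Φ Λ) → Sentence φ₀
    → (CompTrue _≟_ M Ω φ₀ w₀ ⇔ GameTrue _≟_ M Ω φ₀ w₀)
theorem11 lem _≟_ M Ω Γ>0 w₀ φ₀ _ =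
  mk⇔ (λ t → σ , complete φ₀ refl (λ ()) (holds-at refl t))
      (λ (_ , won) → to (Holds⇔ refl refl) (sound won))
  where open Correspondence lem _≟_ M Ω Γ>0 φ₀
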